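{- Let $t$ be a signed polynomial and let $n\in\mathbb{N}$ be the number of its subterms of the form $\mathbf{s}(t')$. Then there are polynomials $t_i$ and $t_{i_j}$, for $1\le i\le 3^n$ and $1\le j\le n$, such that \[\mathrm{Md}\cup\mathrm{Signs}\vdash t=\sum_{i=1}^{3^n}\prod_{j=1}^{n}0_{\phi(\mathbf{s}(t_{i_j}))}\cdot t_i\] where each $\phi(\mathbf{s}(t_{i_j}))\in\{\mathbf{s}(t_{i_j}),\,1+\mathbf{s}(t_{i_j}),\,1-\mathbf{s}(t_{i_j})\}$.
   Context: Polynomials are terms over $(0,1,+,\cdot,-)$; signed polynomials are terms over $(0,1,+,\cdot,-,\mathbf{s})$ with $\mathbf{s}$ a unary function symbol. $\mathrm{Md}$ is the set of equational axioms for meadows: the commutative ring with unit axioms plus $(x^{ -1})^{ -1}=x$ and $x\cdot(x\cdot x^{ -1})=x$. Write $1_x=x\cdot x^{ -1}$ and $0_x=1-1_x$. $\mathrm{Signs}$ consists of: $\mathbf{s}(1_x)=1_x$, $\mathbf{s}(0_x)=0_x$, $\mathbf{s}(-1)=-1$, $\mathbf{s}(x^{ -1})=\mathbf{s}(x)$, $\mathbf{s}(x\cdot y)=\mathbf{s}(x)\cdot\mathbf{s}(y)$, $0_{\mathbf{s}(x)-\mathbf{s}(y)}\cdot(\mathbf{s}(x+y)-\mathbf{s}(x))=0$. $\vdash$ denotes equational derivability. -}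

module Defs where

open import Data.Nat using (ℕ; zero; suc; _+_)
open import Data.Fin using (Fin; zero; suc)
open import Data.Unit using (⊤)
open import Data.Product using (_×_)

infixl 6 _⊕_
infixl 7 _⊗_

data Term : Set where
  var : ℕ → Term
  𝟎 𝟏 : Term
  _⊕_ _⊗_ : Term → Term → Term
  ⊖_ : Term → Term
  _⁻¹ : Term → Term
  𝐬 : Term → Term

_⊝_ : Term → Term → Term
x ⊝ y = x ⊕ (⊖ y)

𝟙 : Term → Term
𝟙 x = x ⊗ (x ⁻¹)

𝟘 : Term → Term
𝟘 x = 𝟏 ⊝ (𝟙 x)

IsPoly : Term → Set
IsPoly (var _) = ⊤
IsPoly 𝟎 = ⊤
IsPoly 𝟏 = ⊤
IsPoly (x ⊕ y) = IsPoly x × IsPoly y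
IsPoly (x ⊗ y) = IsPoly x × IsPoly y
IsPoly (⊖ x) = IsPoly x
IsPoly (x ⁻¹) = E.⊥ where import Data.Empty as E
IsPoly (𝐬 x) = E.⊥ where import Data.Empty as E

IsSignedPoly : Term → Set
IsSignedPoly (var _) = ⊤
IsSignedPoly 𝟎 = ⊤
IsSignedPoly 𝟏 = ⊤
IsSignedPoly (x ⊕ y) = IsSignedPoly x × IsSignedPoly y
IsSignedPoly (x ⊗ y) = IsSignedPoly x × IsSignedPoly y
IsSignedPoly (⊖ x) = IsSignedPoly x
IsSignedPoly (x ⁻¹) = E.⊥ where import Data.Empty as E
IsSignedPoly (𝐬 x) = IsSignedPoly x

sCount : Term → ℕ
sCount (var _) = 0
sCount 𝟎 = 0
sCount 𝟏 = 0
sCount (x ⊕ y) = sCount x + sCount y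
sCount (x ⊗ y) = sCount x + sCount y
sCount (⊖ x) = sCount x
sCount (x ⁻¹) = sCount x
sCount (𝐬 x) = suc (sCount x)

-- Axiom schemes of Md ∪ Signs (all instances, i.e. closed under substitution)
data Ax : Term → Term → Set where
  +-assoc : ∀ x y z → Ax ((x ⊕ y) ⊕ z) (x ⊕ (y ⊕ z))
  +-comm  : ∀ x y → Ax (x ⊕ y) (y ⊕ x)
  +-id    : ∀ x → Ax (x ⊕ 𝟎) x
  +-inv   : ∀ x → Ax (x ⊕ (⊖ x)) 𝟎
  *-assoc : ∀ x y z → Ax ((x ⊗ y) ⊗ z) (x ⊗ (y ⊗ z))
  *-comm  : ∀ x y → Ax (x ⊗ y) (y ⊗ x)
  *-id    : ∀ x → Ax (x ⊗ 𝟏) x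
  distr   : ∀ x y z → Ax (x ⊗ (y ⊕ z)) ((x ⊗ y) ⊕ (x ⊗ z))
  inv-inv : ∀ x → Ax ((x ⁻¹) ⁻¹) x
  ril     : ∀ x → Ax (x ⊗ (x ⊗ (x ⁻¹))) x
  s-1x    : ∀ x → Ax (𝐬 (𝟙 x)) (𝟙 x)
  s-0x    : ∀ x → Ax (𝐬 (𝟘 x)) (𝟘 x)
  s-m1    : Ax (𝐬 (⊖ 𝟏)) (⊖ 𝟏)
  s-inv   : ∀ x → Ax (𝐬 (x ⁻¹)) (𝐬 x)
  s-mul   : ∀ x y → Ax (𝐬 (x ⊗ y)) (𝐬 x ⊗ 𝐬 y)
  s-add   : ∀ x y → Ax (𝟘 (𝐬 x ⊝ 𝐬 y) ⊗ (𝐬 (x ⊕ y) ⊝ 𝐬 x)) 𝟎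

infix 4 _⊢_≈_
data MdSigns : Set where
  MdSigns′ : MdSigns

data _⊢_≈_ : MdSigns → Term → Term → Set where
  ax    : ∀ {s t} → Ax s t → MdSigns′ ⊢ s ≈ t
  refl  : ∀ {t} → MdSigns′ ⊢ t ≈ t
  sym   : ∀ {s t} → MdSigns′ ⊢ s ≈ t → MdSigns′ ⊢ t ≈ s
  trans : ∀ {s t u} → MdSigns′ ⊢ s ≈ t → MdSigns′ ⊢ t ≈ u → MdSigns′ ⊢ s ≈ u
  cong-⊕ : ∀ {a b c d} → MdSigns′ ⊢ a ≈ b → MdSigns′ ⊢ c ≈ d → MdSigns′ ⊢ a ⊕ c ≈ b ⊕ d
  cong-⊗ : ∀ {a b c d} → MdSigns′ ⊢ a ≈ b → MdSigns′ ⊢ c ≈ d → MdSigns′ ⊢ a ⊗ c ≈ b ⊗ d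
  cong-⊖ : ∀ {a b} → MdSigns′ ⊢ a ≈ b → MdSigns′ ⊢ ⊖ a ≈ ⊖ b
  cong-⁻¹ : ∀ {a b} → MdSigns′ ⊢ a ≈ b → MdSigns′ ⊢ a ⁻¹ ≈ b ⁻¹
  cong-𝐬 : ∀ {a b} → MdSigns′ ⊢ a ≈ b → MdSigns′ ⊢ 𝐬 a ≈ 𝐬 b

data Shape : Set where
  plain onePlus oneMinus : Shape

φ : Shape → Term → Term
φ plain    u = 𝐬 u
φ onePlus  u = 𝟏 ⊕ 𝐬 u
φ oneMinus u = 𝟏 ⊝ 𝐬 u

Σᵗ : (k : ℕ) → (Fin k → Term) → Term
Σᵗ zero f = 𝟎
Σᵗ (suc k) f = f zero ⊕ Σᵗ k (λ i → f (suc i))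

Πᵗ : (k : ℕ) → (Fin k → Term) → Term
Πᵗ zero f = 𝟏
Πᵗ (suc k) f = f zero ⊗ Πᵗ k (λ i → f (suc i))

-- For a = 𝐬 u the sign axioms give a² = 1_u and hence a³ = a; they also make 2 invertible, since
-- 𝐬 (1 + 1) = 𝐬 1 = 1 forces 1_{1+1} = 𝐬 (1 + 1)² = 1. Consequently 0_a = 1 − a²,
-- 0_{1−a} = (a² + a)/2 and 0_{1+a} = (a² − a)/2 are the indicator polynomials of 0, 1, −1 on
-- {−1, 0, 1}: they sum to 1, and multiplying by them turns a into 0, 1, −1 respectively. Each of them
-- is fixed by 𝐬 and 𝐬 is multiplicative, so such a factor can be pushed through every term former of a
-- signed polynomial down to an innermost occurrence 𝐬 u (u a polynomial), where it replaces 𝐬 u by the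
-- constant. This writes t as a sum of three guarded signed polynomials with one occurrence of 𝐬 fewer,
-- and induction on the number of occurrences yields the 3ⁿ summands.

module Submission where

open import Algebra.Bundles using (CommutativeRing)
open import Algebra.Solver.Ring.AlmostCommutativeRing
  using (_-Raw-AlmostCommutative⟶_; fromCommutativeRing)
open import Data.Empty using (⊥-elim)
open import Data.Fin using (Fin; zero; suc; _↑ˡ_; _↑ʳ_)
open import Data.Integer as ℤ using (ℤ; +_; -[1+_])
import Data.Integer.Properties as ℤ
open import Data.Maybe using (Maybe; just; nothing)
open import Data.Nat as ℕ using (ℕ; zero; suc; _^_)
import Data.Nat.Properties as ℕ
open import Data.Product using (Σ; Σ-syntax; ∃₂; _×_; _,_; proj₁; proj₂)
open import Data.Sum using (_⊎_; inj₁; inj₂)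
import Data.Sign as Sign
open import Data.Unit using (tt)
open import Data.Vec.Functional using (Vector; []; _∷_; _++_)
open import Data.Vec.Functional.Properties using (lookup-++ˡ; lookup-++ʳ)
open import Function using (_∘_)
open import Level using (0ℓ)
open import Relation.Binary.PropositionalEquality as ≡ using (_≡_)
open import Relation.Nullary using (yes; no)

module ℤ-Embedding {c ℓ} (R : CommutativeRing c ℓ) where

  open CommutativeRing R
  open import Algebra.Properties.Ring ring
  -- The optimised multiple has 1 ×ₙ x = x, so the solver constant con (+ 1) is 1# on the nose.
  open import Algebra.Properties.Semiring.Mult.TCOptimised semiring renaming (_×_ to _×ₙ_)
  open import Relation.Binary.Reasoning.Setoid setoid

  fromℤ : ℤ → Carrier
  fromℤ (+ n)    = n ×ₙ 1#
  fromℤ -[1+ n ] = - (suc n ×ₙ 1#)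

  fromℤ-⊖ : ∀ m n → fromℤ (m ℤ.⊖ n) ≈ m ×ₙ 1# - n ×ₙ 1#
  fromℤ-⊖ m       zero    = sym (trans (+-congˡ -0#≈0#) (+-identityʳ _))
  fromℤ-⊖ zero    (suc n) = sym (+-identityˡ _)
  fromℤ-⊖ (suc m) (suc n) = begin
    fromℤ (suc m ℤ.⊖ suc n)             ≡⟨ ≡.cong fromℤ (ℤ.[1+m]⊖[1+n]≡m⊖n m n) ⟩
    fromℤ (m ℤ.⊖ n)                     ≈⟨ fromℤ-⊖ m n ⟩
    a - b                               ≈⟨ xyx⁻¹≈y 1# (a - b) ⟨
    1# + (a - b) - 1#                   ≈⟨ +-congʳ (+-assoc 1# a (- b)) ⟨
    1# + a - b - 1#                     ≈⟨ +-assoc (1# + a) (- b) (- 1#) ⟩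
    (1# + a) + (- b - 1#)               ≈⟨ +-congˡ (-‿anti-homo-+ 1# b) ⟨
    (1# + a) - (1# + b)                 ≈⟨ +-cong (1+× m 1#) (-‿cong (1+× n 1#)) ⟨
    suc m ×ₙ 1# - suc n ×ₙ 1#           ∎
    where a = m ×ₙ 1#; b = n ×ₙ 1#

  fromℤ-+ : ∀ i j → fromℤ (i ℤ.+ j) ≈ fromℤ i + fromℤ j
  fromℤ-+ (+ m)    (+ n)    = ×-homo-+ 1# m n
  fromℤ-+ (+ m)    -[1+ n ] = fromℤ-⊖ m (suc n)
  fromℤ-+ -[1+ m ] (+ n)    = trans (fromℤ-⊖ n (suc m)) (+-comm _ _)
  fromℤ-+ -[1+ m ] -[1+ n ] = begin
    - (suc (suc (m ℕ.+ n)) ×ₙ 1#)         ≡⟨ ≡.cong (λ k → - (suc k ×ₙ 1#)) (ℕ.+-suc m n) ⟨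
    - ((suc m ℕ.+ suc n) ×ₙ 1#)           ≈⟨ -‿cong (×-homo-+ 1# (suc m) (suc n)) ⟩
    - (suc m ×ₙ 1# + suc n ×ₙ 1#)          ≈⟨ -‿+-comm _ _ ⟨
    - (suc m ×ₙ 1#) - (suc n ×ₙ 1#)        ∎

  fromℤ-+◃ : ∀ k → fromℤ (Sign.+ ℤ.◃ k) ≈ k ×ₙ 1#
  fromℤ-+◃ zero    = refl
  fromℤ-+◃ (suc k) = refl

  fromℤ--◃ : ∀ k → fromℤ (Sign.- ℤ.◃ k) ≈ - (k ×ₙ 1#)
  fromℤ--◃ zero    = sym -0#≈0#
  fromℤ--◃ (suc k) = refl

  fromℤ-* : ∀ i j → fromℤ (i ℤ.* j) ≈ fromℤ i * fromℤ j
  fromℤ-* (+ m)    (+ n)    = trans (fromℤ-+◃ (m ℕ.* n)) (×1-homo-* m n)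
  fromℤ-* (+ m)    -[1+ n ] = begin
    fromℤ (Sign.- ℤ.◃ (m ℕ.* suc n))     ≈⟨ fromℤ--◃ (m ℕ.* suc n) ⟩
    - ((m ℕ.* suc n) ×ₙ 1#)               ≈⟨ -‿cong (×1-homo-* m (suc n)) ⟩
    - (m ×ₙ 1# * suc n ×ₙ 1#)              ≈⟨ -‿distribʳ-* _ _ ⟩
    m ×ₙ 1# * - (suc n ×ₙ 1#)              ∎
  fromℤ-* -[1+ m ] (+ n)    = begin
    fromℤ (Sign.- ℤ.◃ (suc m ℕ.* n))     ≈⟨ fromℤ--◃ (suc m ℕ.* n) ⟩
    - ((suc m ℕ.* n) ×ₙ 1#)               ≈⟨ -‿cong (×1-homo-* (suc m) n) ⟩
    - (suc m ×ₙ 1# * n ×ₙ 1#)              ≈⟨ -‿distribˡ-* _ _ ⟩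
    - (suc m ×ₙ 1#) * n ×ₙ 1#              ∎
  fromℤ-* -[1+ m ] -[1+ n ] = begin
    fromℤ (Sign.+ ℤ.◃ (suc m ℕ.* suc n)) ≈⟨ fromℤ-+◃ (suc m ℕ.* suc n) ⟩
    (suc m ℕ.* suc n) ×ₙ 1#               ≈⟨ ×1-homo-* (suc m) (suc n) ⟩
    a * b                                ≈⟨ -‿involutive (a * b) ⟨
    - - (a * b)                          ≈⟨ -‿cong (-‿distribˡ-* a b) ⟩
    - (- a * b)                          ≈⟨ -‿distribʳ-* (- a) b ⟩
    - a * - b                            ∎
    where a = suc m ×ₙ 1#; b = suc n ×ₙ 1#

  fromℤ-- : ∀ i → fromℤ (ℤ.- i) ≈ - fromℤ i
  fromℤ-- (+ zero)  = sym -0#≈0#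
  fromℤ-- (+ suc n) = refl
  fromℤ-- -[1+ n ]  = sym (-‿involutive _)

  fromℤ-homomorphism : ℤ.+-*-rawRing -Raw-AlmostCommutative⟶ fromCommutativeRing R
  fromℤ-homomorphism = record
    { ⟦_⟧    = fromℤ
    ; +-homo = fromℤ-+
    ; *-homo = fromℤ-*
    ; -‿homo = fromℤ--
    ; 0-homo = refl
    ; 1-homo = refl
    }

  fromℤ-≟ : ∀ i j → Maybe (fromℤ i ≈ fromℤ j)
  fromℤ-≟ i j with i ℤ.≟ j
  ... | yes ≡.refl = just refl
  ... | no _       = nothing

open import Defs

infix 4 _≋_
_≋_ : Term → Term → Set
a ≋ b = MdSigns′ ⊢ a ≈ b

termCommutativeRing : CommutativeRing 0ℓ 0ℓ
termCommutativeRing = record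
  { Carrier = Term ; _≈_ = _≋_ ; _+_ = _⊕_ ; _*_ = _⊗_ ; -_ = ⊖_ ; 0# = 𝟎 ; 1# = 𝟏
  ; isCommutativeRing = record
    { isRing = record
      { +-isAbelianGroup = record
        { isGroup = record
          { isMonoid = record
            { isSemigroup = record
              { isMagma = record
                { isEquivalence = record { refl = refl ; sym = sym ; trans = trans }
                ; ∙-cong = cong-⊕ }
              ; assoc = λ x y z → ax (+-assoc x y z) }
            ; identity = (λ x → trans (ax (+-comm 𝟎 x)) (ax (+-id x))) , (λ x → ax (+-id x)) }
          ; inverse = (λ x → trans (ax (+-comm (⊖ x) x)) (ax (+-inv x))) , (λ x → ax (+-inv x))
          ; ⁻¹-cong = cong-⊖ }
        ; comm = λ x y → ax (+-comm x y) }
      ; *-cong = cong-⊗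
      ; *-assoc = λ x y z → ax (*-assoc x y z)
      ; *-identity = (λ x → trans (ax (*-comm 𝟏 x)) (ax (*-id x))) , (λ x → ax (*-id x))
      ; distrib = (λ x y z → ax (distr x y z))
                , (λ x y z → trans (ax (*-comm (y ⊕ z) x))
                               (trans (ax (distr x y z)) (cong-⊕ (ax (*-comm x y)) (ax (*-comm x z))))) }
    ; *-comm = λ x y → ax (*-comm x y) } }

module T = CommutativeRing termCommutativeRing
open ℤ-Embedding termCommutativeRing using (fromℤ-homomorphism; fromℤ-≟)
open import Algebra.Solver.Ring ℤ.+-*-rawRing (fromCommutativeRing termCommutativeRing)
  fromℤ-homomorphism fromℤ-≟ using (solve; _:=_; _:+_; _:*_; _:-_; :-_; con)
open import Algebra.Properties.Ring T.ring using (x∙y⁻¹≈ε⇒x≈y)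
open import Relation.Binary.Reasoning.Setoid T.setoid

≋-modulo : ∀ {p q d d′ x} → d ≋ d′ → p ≋ q ⊕ (d ⊝ d′) ⊗ x → p ≋ q
≋-modulo {p} {q} {d} {d′} {x} d≋d′ p≋ = begin
  p                    ≈⟨ p≋ ⟩
  q ⊕ (d ⊝ d′) ⊗ x     ≈⟨ T.+-congˡ (T.*-congʳ (T.+-congʳ d≋d′)) ⟩
  q ⊕ (d′ ⊝ d′) ⊗ x    ≈⟨ solve 3 (λ q d′ x → q :+ (d′ :- d′) :* x := q) refl q d′ x ⟩
  q                    ∎

𝟙-unique : ∀ {x y e} → x ⊗ y ≋ e → x ⊗ e ≋ x → 𝟙 x ≋ e
𝟙-unique {x} {y} {e} xy≋e xe≋x = begin
  x ⊗ x ⁻¹                   ≈⟨ T.*-congʳ xe≋x ⟨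
  (x ⊗ e) ⊗ x ⁻¹             ≈⟨ solve 3 (λ x e x′ → (x :* e) :* x′ := e :* (x :* x′)) refl x e (x ⁻¹) ⟩
  e ⊗ 𝟙 x                    ≈⟨ T.*-congʳ xy≋e ⟨
  (x ⊗ y) ⊗ 𝟙 x              ≈⟨ solve 3 (λ x y x′ → (x :* y) :* (x :* x′) := (x :* (x :* x′)) :* y) refl x y (x ⁻¹) ⟩
  (x ⊗ 𝟙 x) ⊗ y              ≈⟨ T.*-congʳ (ax (ril x)) ⟩
  x ⊗ y                      ≈⟨ xy≋e ⟩
  e                          ∎

𝟘-cong : ∀ {a b} → a ≋ b → 𝟘 a ≋ 𝟘 b
𝟘-cong a≋b = cong-⊕ refl (cong-⊖ (cong-⊗ a≋b (cong-⁻¹ a≋b)))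

𝟘𝟎≋𝟏 : 𝟘 𝟎 ≋ 𝟏
𝟘𝟎≋𝟏 = solve 1 (λ z → con (+ 1) :- con (+ 0) :* z := con (+ 1)) refl (𝟎 ⁻¹)

𝟙𝟏≋𝟏 : 𝟙 𝟏 ≋ 𝟏
𝟙𝟏≋𝟏 = 𝟙-unique (ax (*-id 𝟏)) (ax (*-id 𝟏))

𝐬²≋𝟙 : ∀ u → 𝐬 u ⊗ 𝐬 u ≋ 𝟙 u
𝐬²≋𝟙 u = begin
  𝐬 u ⊗ 𝐬 u          ≈⟨ T.*-congˡ (ax (s-inv u)) ⟨
  𝐬 u ⊗ 𝐬 (u ⁻¹)     ≈⟨ ax (s-mul u (u ⁻¹)) ⟨
  𝐬 (𝟙 u)            ≈⟨ ax (s-1x u) ⟩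
  𝟙 u                ∎

𝐬³≋𝐬 : ∀ u → 𝐬 u ⊗ (𝐬 u ⊗ 𝐬 u) ≋ 𝐬 u
𝐬³≋𝐬 u = begin
  𝐬 u ⊗ (𝐬 u ⊗ 𝐬 u)  ≈⟨ T.*-congˡ (𝐬²≋𝟙 u) ⟩
  𝐬 u ⊗ 𝟙 u          ≈⟨ T.*-congˡ (ax (s-1x u)) ⟨
  𝐬 u ⊗ 𝐬 (𝟙 u)      ≈⟨ ax (s-mul u (𝟙 u)) ⟨
  𝐬 (u ⊗ 𝟙 u)        ≈⟨ cong-𝐬 (ax (ril u)) ⟩
  𝐬 u                ∎

𝐬𝟏≋𝟏 : 𝐬 𝟏 ≋ 𝟏
𝐬𝟏≋𝟏 = begin
  𝐬 𝟏                ≈⟨ cong-𝐬 𝟙𝟏≋𝟏 ⟨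
  𝐬 (𝟙 𝟏)            ≈⟨ ax (s-1x 𝟏) ⟩
  𝟙 𝟏                ≈⟨ 𝟙𝟏≋𝟏 ⟩
  𝟏                  ∎

𝐬𝟐≋𝟏 : 𝐬 (𝟏 ⊕ 𝟏) ≋ 𝟏
𝐬𝟐≋𝟏 = trans (x∙y⁻¹≈ε⇒x≈y (𝐬 (𝟏 ⊕ 𝟏)) (𝐬 𝟏) 𝐬𝟐⊝𝐬𝟏≋𝟎) 𝐬𝟏≋𝟏
  where
  𝐬𝟐⊝𝐬𝟏≋𝟎 : 𝐬 (𝟏 ⊕ 𝟏) ⊝ 𝐬 𝟏 ≋ 𝟎
  𝐬𝟐⊝𝐬𝟏≋𝟎 = begin
    𝐬 (𝟏 ⊕ 𝟏) ⊝ 𝐬 𝟏                       ≈⟨ T.*-identityˡ _ ⟨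
    𝟏 ⊗ (𝐬 (𝟏 ⊕ 𝟏) ⊝ 𝐬 𝟏)                 ≈⟨ T.*-congʳ (trans (𝟘-cong (ax (+-inv (𝐬 𝟏)))) 𝟘𝟎≋𝟏) ⟨
    𝟘 (𝐬 𝟏 ⊝ 𝐬 𝟏) ⊗ (𝐬 (𝟏 ⊕ 𝟏) ⊝ 𝐬 𝟏)     ≈⟨ ax (s-add 𝟏 𝟏) ⟩
    𝟎                                     ∎

½ : Term
½ = (𝟏 ⊕ 𝟏) ⁻¹

𝟐⊗½≋𝟏 : (𝟏 ⊕ 𝟏) ⊗ ½ ≋ 𝟏
𝟐⊗½≋𝟏 = begin
  𝟙 (𝟏 ⊕ 𝟏)                 ≈⟨ 𝐬²≋𝟙 (𝟏 ⊕ 𝟏) ⟨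
  𝐬 (𝟏 ⊕ 𝟏) ⊗ 𝐬 (𝟏 ⊕ 𝟏)     ≈⟨ T.*-cong 𝐬𝟐≋𝟏 𝐬𝟐≋𝟏 ⟩
  𝟏 ⊗ 𝟏                     ≈⟨ ax (*-id 𝟏) ⟩
  𝟏                         ∎

𝟘-cubic : ∀ {b} → b ⊗ (b ⊗ b) ≋ b → 𝟘 b ≋ 𝟏 ⊝ (b ⊗ b)
𝟘-cubic b³≋b = cong-⊕ refl (cong-⊖ (𝟙-unique refl b³≋b))

𝟘-1-cubic : ∀ {b} → b ⊗ (b ⊗ b) ≋ b → 𝟘 (𝟏 ⊝ b) ≋ (b ⊗ b ⊕ b) ⊗ ½
𝟘-1-cubic {b} b³≋b = begin
  𝟘 (𝟏 ⊝ b)                        ≈⟨ cong-⊕ refl (cong-⊖ (𝟙-unique xy≋e xe≋x)) ⟩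
  𝟏 ⊝ (𝟏 ⊝ ((b ⊗ b ⊕ b) ⊗ ½))      ≈⟨ solve 2 (λ b h →
                                        con (+ 1) :- (con (+ 1) :- (b :* b :+ b) :* h) := (b :* b :+ b) :* h)
                                        refl b ½ ⟩
  (b ⊗ b ⊕ b) ⊗ ½                  ∎
  where
  -- 𝟏 ⊕ (𝟏 ⊝ ½) ⊗ b inverts 1 − b at b = 0 and b = −1.
  xy≋e : (𝟏 ⊝ b) ⊗ (𝟏 ⊕ (𝟏 ⊝ ½) ⊗ b) ≋ 𝟏 ⊝ ((b ⊗ b ⊕ b) ⊗ ½)
  xy≋e = ≋-modulo 𝟐⊗½≋𝟏 (solve 2 (λ b h →
    (con (+ 1) :- b) :* (con (+ 1) :+ (con (+ 1) :- h) :* b)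
      := (con (+ 1) :- (b :* b :+ b) :* h) :+ ((con (+ 1) :+ con (+ 1)) :* h :- con (+ 1)) :* (b :* b)) refl b ½)
  xe≋x : (𝟏 ⊝ b) ⊗ (𝟏 ⊝ ((b ⊗ b ⊕ b) ⊗ ½)) ≋ 𝟏 ⊝ b
  xe≋x = ≋-modulo b³≋b (solve 2 (λ b h →
    (con (+ 1) :- b) :* (con (+ 1) :- (b :* b :+ b) :* h)
      := (con (+ 1) :- b) :+ (b :* (b :* b) :- b) :* h) refl b ½)

𝟘-1+cubic : ∀ {b} → b ⊗ (b ⊗ b) ≋ b → 𝟘 (𝟏 ⊕ b) ≋ ((b ⊗ b) ⊝ b) ⊗ ½
𝟘-1+cubic {b} b³≋b = begin
  𝟘 (𝟏 ⊕ b)                ≈⟨ 𝟘-cong (solve 1 (λ b → con (+ 1) :+ b := con (+ 1) :- (:- b)) refl b) ⟩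
  𝟘 (𝟏 ⊝ (⊖ b))            ≈⟨ 𝟘-1-cubic -b³≋-b ⟩
  (⊖ b ⊗ ⊖ b ⊕ ⊖ b) ⊗ ½    ≈⟨ solve 2 (λ b h → (:- b :* :- b :+ :- b) :* h := (b :* b :- b) :* h) refl b ½ ⟩
  ((b ⊗ b) ⊝ b) ⊗ ½        ∎
  where
  -b³≋-b : ⊖ b ⊗ (⊖ b ⊗ ⊖ b) ≋ ⊖ b
  -b³≋-b = trans (solve 1 (λ b → :- b :* (:- b :* :- b) := :- (b :* (b :* b))) refl b) (cong-⊖ b³≋b)

indicator : Shape → Term → Term
indicator plain    a = 𝟏 ⊝ (a ⊗ a)
indicator oneMinus a = (a ⊗ a ⊕ a) ⊗ ½
indicator onePlus  a = ((a ⊗ a) ⊝ a) ⊗ ½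

φ-root : Shape → Term
φ-root plain    = 𝟎
φ-root oneMinus = 𝟏
φ-root onePlus  = ⊖ 𝟏

𝟘∘φ≋indicator : ∀ sh u → 𝟘 (φ sh u) ≋ indicator sh (𝐬 u)
𝟘∘φ≋indicator plain    u = 𝟘-cubic (𝐬³≋𝐬 u)
𝟘∘φ≋indicator oneMinus u = 𝟘-1-cubic (𝐬³≋𝐬 u)
𝟘∘φ≋indicator onePlus  u = 𝟘-1+cubic (𝐬³≋𝐬 u)

indicator-partition : ∀ a → indicator plain a ⊕ (indicator oneMinus a ⊕ indicator onePlus a) ≋ 𝟏
indicator-partition a = ≋-modulo 𝟐⊗½≋𝟏 (solve 2 (λ a h →
  (con (+ 1) :- a :* a) :+ ((a :* a :+ a) :* h :+ (a :* a :- a) :* h)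
    := con (+ 1) :+ ((con (+ 1) :+ con (+ 1)) :* h :- con (+ 1)) :* (a :* a)) refl a ½)

indicator-selects : ∀ {a} → a ⊗ (a ⊗ a) ≋ a → ∀ sh → indicator sh a ⊗ a ≋ indicator sh a ⊗ φ-root sh
indicator-selects {a} a³≋a plain    = ≋-modulo a³≋a (solve 1 (λ a →
  (con (+ 1) :- a :* a) :* a
    := (con (+ 1) :- a :* a) :* con (+ 0) :+ (a :* (a :* a) :- a) :* con -[1+ 0 ]) refl a)
indicator-selects {a} a³≋a oneMinus = ≋-modulo a³≋a (solve 2 (λ a h →
  (a :* a :+ a) :* h :* a
    := (a :* a :+ a) :* h :* con (+ 1) :+ (a :* (a :* a) :- a) :* h) refl a ½)
indicator-selects {a} a³≋a onePlus  = ≋-modulo a³≋a (solve 2 (λ a h →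
  (a :* a :- a) :* h :* a
    := (a :* a :- a) :* h :* (:- con (+ 1)) :+ (a :* (a :* a) :- a) :* h) refl a ½)

𝟘∘φ-partition : ∀ u → 𝟘 (φ plain u) ⊕ (𝟘 (φ oneMinus u) ⊕ 𝟘 (φ onePlus u)) ≋ 𝟏
𝟘∘φ-partition u = trans
  (cong-⊕ (𝟘∘φ≋indicator plain u) (cong-⊕ (𝟘∘φ≋indicator oneMinus u) (𝟘∘φ≋indicator onePlus u)))
  (indicator-partition (𝐬 u))

𝟘∘φ-selects : ∀ sh u → 𝟘 (φ sh u) ⊗ 𝐬 u ≋ 𝟘 (φ sh u) ⊗ φ-root sh
𝟘∘φ-selects sh u = begin
  𝟘 (φ sh u) ⊗ 𝐬 u                   ≈⟨ T.*-congʳ (𝟘∘φ≋indicator sh u) ⟩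
  indicator sh (𝐬 u) ⊗ 𝐬 u           ≈⟨ indicator-selects (𝐬³≋𝐬 u) sh ⟩
  indicator sh (𝐬 u) ⊗ φ-root sh     ≈⟨ T.*-congʳ (𝟘∘φ≋indicator sh u) ⟨
  𝟘 (φ sh u) ⊗ φ-root sh             ∎

infixl 6 _⊕ˡ_ _⊕ʳ_
infixl 7 _⊗ˡ_ _⊗ʳ_
infix 30 _[_]

data Context : Set where
  ∙           : Context
  _⊕ˡ_ _⊗ˡ_   : Context → Term → Context
  _⊕ʳ_ _⊗ʳ_   : Term → Context → Context
  ⊖ᶜ_ 𝐬ᶜ      : Context → Context

_[_] : Context → Term → Term
∙        [ a ] = a
(C ⊕ˡ y) [ a ] = C [ a ] ⊕ y
(C ⊗ˡ y) [ a ] = C [ a ] ⊗ y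
(x ⊕ʳ C) [ a ] = x ⊕ C [ a ]
(x ⊗ʳ C) [ a ] = x ⊗ C [ a ]
(⊖ᶜ C)   [ a ] = ⊖ C [ a ]
(𝐬ᶜ C)   [ a ] = 𝐬 (C [ a ])

IsPoly⇒sCount≡0 : ∀ t → IsPoly t → sCount t ≡ 0
IsPoly⇒sCount≡0 (var _) _         = ≡.refl
IsPoly⇒sCount≡0 𝟎       _         = ≡.refl
IsPoly⇒sCount≡0 𝟏       _         = ≡.refl
IsPoly⇒sCount≡0 (x ⊕ y) (px , py) = ≡.cong₂ ℕ._+_ (IsPoly⇒sCount≡0 x px) (IsPoly⇒sCount≡0 y py)
IsPoly⇒sCount≡0 (x ⊗ y) (px , py) = ≡.cong₂ ℕ._+_ (IsPoly⇒sCount≡0 x px) (IsPoly⇒sCount≡0 y py)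
IsPoly⇒sCount≡0 (⊖ x)   px        = IsPoly⇒sCount≡0 x px

IsPoly⇒IsSignedPoly : ∀ t → IsPoly t → IsSignedPoly t
IsPoly⇒IsSignedPoly (var _) _         = tt
IsPoly⇒IsSignedPoly 𝟎       _         = tt
IsPoly⇒IsSignedPoly 𝟏       _         = tt
IsPoly⇒IsSignedPoly (x ⊕ y) (px , py) = IsPoly⇒IsSignedPoly x px , IsPoly⇒IsSignedPoly y py
IsPoly⇒IsSignedPoly (x ⊗ y) (px , py) = IsPoly⇒IsSignedPoly x px , IsPoly⇒IsSignedPoly y py
IsPoly⇒IsSignedPoly (⊖ x)   px        = IsPoly⇒IsSignedPoly x px

φ-root-poly : ∀ sh → IsPoly (φ-root sh)
φ-root-poly plain    = tt
φ-root-poly oneMinus = tt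
φ-root-poly onePlus  = tt

IsPoly⊎redex : ∀ t → IsSignedPoly t → IsPoly t ⊎ ∃₂ λ C u → IsPoly u × t ≡ C [ 𝐬 u ]
IsPoly⊎redex (var _) _ = inj₁ tt
IsPoly⊎redex 𝟎       _ = inj₁ tt
IsPoly⊎redex 𝟏       _ = inj₁ tt
IsPoly⊎redex (x ⊕ y) (sx , sy) with IsPoly⊎redex x sx | IsPoly⊎redex y sy
... | inj₂ (C , u , pu , ≡.refl) | _                        = inj₂ (C ⊕ˡ y , u , pu , ≡.refl)
... | inj₁ px                   | inj₂ (C , u , pu , ≡.refl) = inj₂ (x ⊕ʳ C , u , pu , ≡.refl)
... | inj₁ px                   | inj₁ py                   = inj₁ (px , py)
IsPoly⊎redex (x ⊗ y) (sx , sy) with IsPoly⊎redex x sx | IsPoly⊎redex y sy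
... | inj₂ (C , u , pu , ≡.refl) | _                        = inj₂ (C ⊗ˡ y , u , pu , ≡.refl)
... | inj₁ px                   | inj₂ (C , u , pu , ≡.refl) = inj₂ (x ⊗ʳ C , u , pu , ≡.refl)
... | inj₁ px                   | inj₁ py                   = inj₁ (px , py)
IsPoly⊎redex (⊖ x) sx with IsPoly⊎redex x sx
... | inj₁ px                   = inj₁ px
... | inj₂ (C , u , pu , ≡.refl) = inj₂ (⊖ᶜ C , u , pu , ≡.refl)
IsPoly⊎redex (𝐬 x) sx with IsPoly⊎redex x sx
... | inj₁ px                   = inj₂ (∙ , x , px , ≡.refl)
... | inj₂ (C , u , pu , ≡.refl) = inj₂ (𝐬ᶜ C , u , pu , ≡.refl)

plug-IsSignedPoly : ∀ C {a b} → IsSignedPoly (C [ a ]) → IsSignedPoly b → IsSignedPoly (C [ b ])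
plug-IsSignedPoly ∙        _         sb = sb
plug-IsSignedPoly (C ⊕ˡ y) (sC , sy) sb = plug-IsSignedPoly C sC sb , sy
plug-IsSignedPoly (C ⊗ˡ y) (sC , sy) sb = plug-IsSignedPoly C sC sb , sy
plug-IsSignedPoly (x ⊕ʳ C) (sx , sC) sb = sx , plug-IsSignedPoly C sC sb
plug-IsSignedPoly (x ⊗ʳ C) (sx , sC) sb = sx , plug-IsSignedPoly C sC sb
plug-IsSignedPoly (⊖ᶜ C)   sC        sb = plug-IsSignedPoly C sC sb
plug-IsSignedPoly (𝐬ᶜ C)   sC        sb = plug-IsSignedPoly C sC sb

sCount-plug-cong : ∀ C {a b} → sCount a ≡ sCount b → sCount (C [ a ]) ≡ sCount (C [ b ])
sCount-plug-cong ∙        eq = eq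
sCount-plug-cong (C ⊕ˡ y) eq = ≡.cong (ℕ._+ sCount y) (sCount-plug-cong C eq)
sCount-plug-cong (C ⊗ˡ y) eq = ≡.cong (ℕ._+ sCount y) (sCount-plug-cong C eq)
sCount-plug-cong (x ⊕ʳ C) eq = ≡.cong (sCount x ℕ.+_) (sCount-plug-cong C eq)
sCount-plug-cong (x ⊗ʳ C) eq = ≡.cong (sCount x ℕ.+_) (sCount-plug-cong C eq)
sCount-plug-cong (⊖ᶜ C)   eq = sCount-plug-cong C eq
sCount-plug-cong (𝐬ᶜ C)   eq = ≡.cong suc (sCount-plug-cong C eq)

sCount-plug-𝐬 : ∀ C a → sCount (C [ 𝐬 a ]) ≡ suc (sCount (C [ a ]))
sCount-plug-𝐬 ∙        a = ≡.refl
sCount-plug-𝐬 (C ⊕ˡ y) a = ≡.cong (ℕ._+ sCount y) (sCount-plug-𝐬 C a)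
sCount-plug-𝐬 (C ⊗ˡ y) a = ≡.cong (ℕ._+ sCount y) (sCount-plug-𝐬 C a)
sCount-plug-𝐬 (x ⊕ʳ C) a = ≡.trans (≡.cong (sCount x ℕ.+_) (sCount-plug-𝐬 C a)) (ℕ.+-suc (sCount x) _)
sCount-plug-𝐬 (x ⊗ʳ C) a = ≡.trans (≡.cong (sCount x ℕ.+_) (sCount-plug-𝐬 C a)) (ℕ.+-suc (sCount x) _)
sCount-plug-𝐬 (⊖ᶜ C)   a = sCount-plug-𝐬 C a
sCount-plug-𝐬 (𝐬ᶜ C)   a = ≡.cong suc (sCount-plug-𝐬 C a)

plug-guarded : ∀ {q a b} → 𝐬 q ≋ q → q ⊗ a ≋ q ⊗ b → ∀ C → q ⊗ C [ a ] ≋ q ⊗ C [ b ]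
plug-guarded {q} {a} {b} 𝐬q≋q qa≋qb = go
  where
  through : (F G : Term → Term) → (∀ z → q ⊗ F z ≋ G (q ⊗ z)) → (∀ {w w′} → w ≋ w′ → G w ≋ G w′) →
            ∀ {z z′} → q ⊗ z ≋ q ⊗ z′ → q ⊗ F z ≋ q ⊗ F z′
  through F G commute G-cong {z} {z′} qz≋qz′ = trans (commute z) (trans (G-cong qz≋qz′) (sym (commute z′)))

  go : ∀ C → q ⊗ C [ a ] ≋ q ⊗ C [ b ]
  go ∙        = qa≋qb
  go (C ⊕ˡ y) = through (_⊕ y) (_⊕ q ⊗ y) (λ z → ax (distr q z y)) T.+-congʳ (go C)
  go (x ⊕ʳ C) = through (x ⊕_) (q ⊗ x ⊕_) (λ z → ax (distr q x z)) T.+-congˡ (go C)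
  go (C ⊗ˡ y) = through (_⊗ y) (_⊗ y) (λ z → sym (ax (*-assoc q z y))) T.*-congʳ (go C)
  go (x ⊗ʳ C) = through (x ⊗_) (x ⊗_)
    (λ z → solve 3 (λ q x z → q :* (x :* z) := x :* (q :* z)) refl q x z) T.*-congˡ (go C)
  go (⊖ᶜ C)   = through ⊖_ ⊖_ (λ z → solve 2 (λ q z → q :* (:- z) := :- (q :* z)) refl q z) cong-⊖ (go C)
  go (𝐬ᶜ C)   = through 𝐬 𝐬 (λ z → trans (T.*-congʳ (sym 𝐬q≋q)) (sym (ax (s-mul q z)))) cong-𝐬 (go C)

sign-split : ∀ C u →
  C [ 𝐬 u ] ≋ 𝟘 (φ plain u) ⊗ C [ φ-root plain ]
            ⊕ (𝟘 (φ oneMinus u) ⊗ C [ φ-root oneMinus ] ⊕ (𝟘 (φ onePlus u) ⊗ C [ φ-root onePlus ] ⊕ 𝟎))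
sign-split C u = begin
  C [ 𝐬 u ]                                   ≈⟨ T.*-identityˡ _ ⟨
  𝟏 ⊗ C [ 𝐬 u ]                               ≈⟨ T.*-congʳ (𝟘∘φ-partition u) ⟨
  (p plain ⊕ (p oneMinus ⊕ p onePlus)) ⊗ C [ 𝐬 u ]
    ≈⟨ solve 4 (λ x y z t → (x :+ (y :+ z)) :* t := x :* t :+ (y :* t :+ (z :* t :+ con (+ 0))))
             refl (p plain) (p oneMinus) (p onePlus) (C [ 𝐬 u ]) ⟩
  p plain ⊗ C [ 𝐬 u ] ⊕ (p oneMinus ⊗ C [ 𝐬 u ] ⊕ (p onePlus ⊗ C [ 𝐬 u ] ⊕ 𝟎))
    ≈⟨ cong-⊕ (select plain) (cong-⊕ (select oneMinus) (cong-⊕ (select onePlus) refl)) ⟩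
  p plain ⊗ C [ 𝟎 ] ⊕ (p oneMinus ⊗ C [ 𝟏 ] ⊕ (p onePlus ⊗ C [ ⊖ 𝟏 ] ⊕ 𝟎)) ∎
  where
  p : Shape → Term
  p sh = 𝟘 (φ sh u)
  select : ∀ sh → p sh ⊗ C [ 𝐬 u ] ≋ p sh ⊗ C [ φ-root sh ]
  select sh = plug-guarded (ax (s-0x (φ sh u))) (𝟘∘φ-selects sh u) C

Σᵗ-cong : ∀ k {f g : Fin k → Term} → (∀ i → f i ≋ g i) → Σᵗ k f ≋ Σᵗ k g
Σᵗ-cong zero    f≋g = refl
Σᵗ-cong (suc k) f≋g = cong-⊕ (f≋g zero) (Σᵗ-cong k (f≋g ∘ suc))

Σᵗ-*-distribˡ : ∀ k c (f : Fin k → Term) → Σᵗ k (λ i → c ⊗ f i) ≋ c ⊗ Σᵗ k f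
Σᵗ-*-distribˡ zero    c f = sym (T.zeroʳ c)
Σᵗ-*-distribˡ (suc k) c f = trans (T.+-congˡ (Σᵗ-*-distribˡ k c (f ∘ suc))) (sym (T.distribˡ c _ _))

Σᵗ-+ : ∀ m {k} (f : Fin (m ℕ.+ k) → Term) → Σᵗ (m ℕ.+ k) f ≋ Σᵗ m (f ∘ (_↑ˡ k)) ⊕ Σᵗ k (f ∘ (m ↑ʳ_))
Σᵗ-+ zero    f = sym (T.+-identityˡ _)
Σᵗ-+ (suc m) f = trans (T.+-congˡ (Σᵗ-+ m (f ∘ suc))) (sym (T.+-assoc _ _ _))

record Summand (n : ℕ) : Set where
  field
    coefficient      : Term
    arguments        : Fin n → Term
    shapes           : Fin n → Shape
    coefficient-poly : IsPoly coefficient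
    arguments-poly   : ∀ j → IsPoly (arguments j)

  value : Term
  value = Πᵗ n (λ j → 𝟘 (φ (shapes j) (arguments j))) ⊗ coefficient

open Summand

infix 4 _≋Σ_
_≋Σ_ : ∀ {n k} → Term → Vector (Summand n) k → Set
_≋Σ_ {k = k} t ms = t ≋ Σᵗ k (value ∘ ms)

guard : ∀ {n} → Shape → (u : Term) → IsPoly u → Summand n → Summand (suc n)
guard sh u pu m = record
  { coefficient      = coefficient m
  ; arguments        = u ∷ arguments m
  ; shapes           = sh ∷ shapes m
  ; coefficient-poly = coefficient-poly m
  ; arguments-poly   = λ { zero → pu ; (suc j) → arguments-poly m j }
  }

guard-≋Σ : ∀ {n k t} sh u (pu : IsPoly u) {ms : Vector (Summand n) k} →
           t ≋Σ ms → 𝟘 (φ sh u) ⊗ t ≋Σ guard sh u pu ∘ ms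
guard-≋Σ {k = k} sh u pu {ms} t≋Σ = begin
  𝟘 (φ sh u) ⊗ _                                 ≈⟨ T.*-congˡ t≋Σ ⟩
  𝟘 (φ sh u) ⊗ Σᵗ k (value ∘ ms)                 ≈⟨ Σᵗ-*-distribˡ k (𝟘 (φ sh u)) (value ∘ ms) ⟨
  Σᵗ k (λ i → 𝟘 (φ sh u) ⊗ value (ms i))         ≈⟨ Σᵗ-cong k (λ i → sym (ax (*-assoc _ _ _))) ⟩
  Σᵗ k (value ∘ guard sh u pu ∘ ms)              ∎

++-≋Σ : ∀ {n m k s t} {ms : Vector (Summand n) m} {ms′ : Vector (Summand n) k} →
        s ≋Σ ms → t ≋Σ ms′ → s ⊕ t ≋Σ ms ++ ms′
++-≋Σ {m = m} {k} {ms = ms} {ms′} s≋Σ t≋Σ = begin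
  _ ⊕ _                                                          ≈⟨ cong-⊕ s≋Σ t≋Σ ⟩
  Σᵗ m (value ∘ ms) ⊕ Σᵗ k (value ∘ ms′)
    ≈⟨ cong-⊕ (Σᵗ-cong m (λ i → T.reflexive (≡.cong value (lookup-++ˡ ms ms′ i))))
              (Σᵗ-cong k (λ i → T.reflexive (≡.cong value (lookup-++ʳ ms ms′ i)))) ⟨
  Σᵗ m (value ∘ (ms ++ ms′) ∘ (_↑ˡ k)) ⊕ Σᵗ k (value ∘ (ms ++ ms′) ∘ (m ↑ʳ_))
    ≈⟨ Σᵗ-+ m (value ∘ (ms ++ ms′)) ⟨
  Σᵗ (m ℕ.+ k) (value ∘ (ms ++ ms′))                             ∎

SignNormalForm : Term → ℕ → Set
SignNormalForm t n = Σ[ ms ∈ Vector (Summand n) (3 ^ n) ] t ≋Σ ms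

polynomial-normalForm : ∀ t → IsPoly t → SignNormalForm t 0
polynomial-normalForm t pt = (λ _ → summand) , solve 1 (λ t → t := con (+ 1) :* t :+ con (+ 0)) refl t
  where
  summand : Summand 0
  summand = record
    { coefficient = t ; arguments = λ () ; shapes = λ () ; coefficient-poly = pt ; arguments-poly = λ () }

normalForm : ∀ n t → IsSignedPoly t → sCount t ≡ n → SignNormalForm t n
normalForm n t st count with IsPoly⊎redex t st
normalForm zero    t _ _     | inj₁ pt = polynomial-normalForm t pt
normalForm (suc n) t _ count | inj₁ pt =
  ⊥-elim (ℕ.0≢1+n (≡.trans (≡.sym (IsPoly⇒sCount≡0 t pt)) count))
normalForm zero    _ _ count | inj₂ (C , u , _ , ≡.refl) =
  ⊥-elim (ℕ.1+n≢0 (≡.trans (≡.sym (sCount-plug-𝐬 C u)) count))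
normalForm (suc n) _ st count | inj₂ (C , u , pu , ≡.refl) =
  ms plain ++ (ms oneMinus ++ (ms onePlus ++ [])) ,
  trans (sign-split C u) (++-≋Σ (branch-≋Σ plain) (++-≋Σ (branch-≋Σ oneMinus) (++-≋Σ (branch-≋Σ onePlus) refl)))
  where
  count-at-root : ∀ sh → sCount (C [ φ-root sh ]) ≡ n
  count-at-root sh = ≡.trans
    (sCount-plug-cong C (≡.trans (IsPoly⇒sCount≡0 (φ-root sh) (φ-root-poly sh)) (≡.sym (IsPoly⇒sCount≡0 u pu))))
    (ℕ.suc-injective (≡.trans (≡.sym (sCount-plug-𝐬 C u)) count))

  branch : ∀ sh → SignNormalForm (C [ φ-root sh ]) n
  branch sh = normalForm n (C [ φ-root sh ])
    (plug-IsSignedPoly C st (IsPoly⇒IsSignedPoly (φ-root sh) (φ-root-poly sh))) (count-at-root sh)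

  ms : Shape → Vector (Summand (suc n)) (3 ^ n)
  ms sh = guard sh u pu ∘ proj₁ (branch sh)

  branch-≋Σ : ∀ sh → 𝟘 (φ sh u) ⊗ C [ φ-root sh ] ≋Σ ms sh
  branch-≋Σ sh = guard-≋Σ sh u pu {proj₁ (branch sh)} (proj₂ (branch sh))

mainTheorem13 : (t : Term) → IsSignedPoly t →
    Σ (Fin (3 ^ sCount t) → Term) λ tᵢ →
    Σ (Fin (3 ^ sCount t) → Fin (sCount t) → Term) λ tᵢⱼ →
    Σ (Fin (3 ^ sCount t) → Fin (sCount t) → Shape) λ sh →
      ((i : Fin (3 ^ sCount t)) → IsPoly (tᵢ i)) ×
      ((i : Fin (3 ^ sCount t)) → (j : Fin (sCount t)) → IsPoly (tᵢⱼ i j)) ×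
      (MdSigns′ ⊢ t ≈ Σᵗ (3 ^ sCount t) (λ i → Πᵗ (sCount t) (λ j → 𝟘 (φ (sh i j) (tᵢⱼ i j))) ⊗ tᵢ i))
mainTheorem13 t st =
  let ms , t≋Σ = normalForm (sCount t) t st ≡.refl
  in coefficient ∘ ms , arguments ∘ ms , shapes ∘ ms , coefficient-poly ∘ ms , arguments-poly ∘ ms , t≋Σ
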